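{- Let $\mathcal U$ be a nontrivial variety of closure algebras satisfying the McKinsey identity, let $\mathcal W$ be a variety of monadic algebras, and let $\mathcal V=\mathcal U\vee\mathcal W$ be their varietal join. Then for every natural number $k$, $\mathbf F_{\mathcal V}(k)\cong\mathbf F_{\mathcal U}(k)\times\mathbf G_{\mathcal W}(k)$.
   Context: A closure algebra is a Boolean algebra with unary $\Diamond$ satisfying $\Diamond0=0$, $\Diamond(a\vee b)=\Diamond a\vee\Diamond b$, $a\le\Diamond a=\Diamond\Diamond a$; $\Box x=\neg\Diamond\neg x$. It is monadic if $\Diamond\Box a=\Box a$ for all $a$. The McKinsey identity is $(\forall x)\,\Box\Diamond x\Rightarrow\Diamond\Box x\approx1$ (where $a\Rightarrow b=\neg a\vee b$). $\mathbf F_{\mathcal K}(k)$ denotes the free algebra of rank $k$ for a variety $\mathcal K$. For $l\ge1$, $\mathbf S_l$ is the closure algebra whose Boolean reduct has $l$ atoms and whose only closed elements are $0,1$. For a variety $\mathcal W$ of monadic algebras, $\mathbf F_{\mathcal W}(k)$ is (up to isomorphism) a finite product $\mathbf 2^d\times\prod_{l=1}^m\mathbf R_l$ where $\mathbf 2=\mathbf S_1$ is the two-element closure algebra and each $\mathbf R_l\in\{\mathbf S_2,\mathbf S_3,\dots\}$; $\mathbf G_{\mathcal W}(k)$ denotes $\prod_{l=1}^m\mathbf R_l$ (the product of the factors with more than two elements). -}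

module Defs where

open import Level using (Level; _⊔_; 0ℓ) renaming (suc to lsuc)
open import Data.Nat using (ℕ)
open import Data.Fin using (Fin)
open import Data.Bool using (Bool; true; false; if_then_else_) renaming (_∨_ to _or_; _∧_ to _and_; not to bnot)
open import Data.Vec using (Vec; []; _∷_; zipWith; replicate) renaming (map to vmap)
open import Data.List using (List; []; _∷_)
open import Data.Product using (_×_; _,_; Σ; proj₁; proj₂)
open import Data.Unit using (tt) renaming (⊤ to Unit)
open import Relation.Binary using (Rel; IsEquivalence)
open import Relation.Binary.PropositionalEquality using (_≡_) renaming (isEquivalence to ≡-isEquivalence)
import Relation.Nullary as RN
open import Algebra.Lattice.Structures using (IsBooleanAlgebra)

infixr 6 _∨t_
infixr 7 _∧t_
infix 8 ¬t_ ◇t_ □t_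

data Term (X : Set) : Set where
  var      : X → Term X
  ⊥t ⊤t    : Term X
  _∨t_ _∧t_ : Term X → Term X → Term X
  ¬t_ ◇t_  : Term X → Term X

□t_ : {X : Set} → Term X → Term X
□t x = ¬t ◇t ¬t x

_⇒t_ : {X : Set} → Term X → Term X → Term X
x ⇒t y = ¬t x ∨t y

record ClosureAlgebra (c ℓ : Level) : Set (lsuc (c ⊔ ℓ)) where
  infix 4 _≈_
  infixr 6 _∨_
  infixr 7 _∧_
  infix 8 ¬_
  field
    Carrier : Set c
    _≈_     : Rel Carrier ℓ
    _∨_ _∧_ : Carrier → Carrier → Carrier
    ¬_      : Carrier → Carrier
    ⊤ ⊥     : Carrier
    ◇       : Carrier → Carrier
    isBooleanAlgebra : IsBooleanAlgebra _≈_ _∨_ _∧_ ¬_ ⊤ ⊥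
    ◇-cong      : ∀ {a b} → a ≈ b → ◇ a ≈ ◇ b
    ◇-⊥         : ◇ ⊥ ≈ ⊥
    ◇-∨         : ∀ a b → ◇ (a ∨ b) ≈ (◇ a ∨ ◇ b)
    ◇-extensive : ∀ a → (a ∨ ◇ a) ≈ ◇ a
    ◇-idem      : ∀ a → ◇ (◇ a) ≈ ◇ a

  open IsBooleanAlgebra isBooleanAlgebra public using (isEquivalence)

CA₀ : Set₁
CA₀ = ClosureAlgebra 0ℓ 0ℓ

module _ {c ℓ} (A : ClosureAlgebra c ℓ) where
  open ClosureAlgebra A
  eval : {X : Set} → (X → Carrier) → Term X → Carrier
  eval ρ (var x)  = ρ x
  eval ρ ⊥t       = ⊥
  eval ρ ⊤t       = ⊤
  eval ρ (s ∨t t) = eval ρ s ∨ eval ρ t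
  eval ρ (s ∧t t) = eval ρ s ∧ eval ρ t
  eval ρ (¬t s)   = ¬ eval ρ s
  eval ρ (◇t s)   = ◇ (eval ρ s)

  Holds : {X : Set} → Term X → Term X → Set (c ⊔ ℓ)
  Holds s t = ∀ (ρ : _ → Carrier) → eval ρ s ≈ eval ρ t

-- Varieties of closure algebras, presented by a set of identities
-- (over countably many variables).  The variety is the class of closure
-- algebras satisfying all of them.

Identities : Set₂
Identities = Term ℕ → Term ℕ → Set₁

Models : Identities → CA₀ → Set₁
Models E A = ∀ s t → E s t → Holds A s t

Valid : Identities → {X : Set} → Term X → Term X → Set₁
Valid E s t = ∀ (A : CA₀) → Models E A → Holds A s t

Nontrivial : Identities → Set₁
Nontrivial E = Σ CA₀ λ A → Models E A × RN.¬ (ClosureAlgebra._≈_ A (ClosureAlgebra.⊤ A) (ClosureAlgebra.⊥ A))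

McKinsey : Identities → Set₁
McKinsey E = Valid E ((□t ◇t var 0) ⇒t (◇t □t var 0)) ⊤t

MonadicVariety : Identities → Set₁
MonadicVariety E = Valid E (◇t □t var 0) (□t var 0)

join : Identities → Identities → Identities
join E F s t = Valid E s t × Valid F s t

record Alg (c ℓ : Level) : Set (lsuc (c ⊔ ℓ)) where
  infix 4 _≈_
  infixr 6 _∨_
  infixr 7 _∧_
  infix 8 ¬_
  field
    Carrier : Set c
    _≈_     : Rel Carrier ℓ
    isEquivalence : IsEquivalence _≈_
    _∨_ _∧_ : Carrier → Carrier → Carrier
    ¬_      : Carrier → Carrier
    ⊤ ⊥     : Carrier
    ◇       : Carrier → Carrier

record Iso {a b c d} (A : Alg a b) (B : Alg c d) : Set (a ⊔ b ⊔ c ⊔ d) where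
  private
    module A = Alg A
    module B = Alg B
  field
    to        : A.Carrier → B.Carrier
    from      : B.Carrier → A.Carrier
    to-cong   : ∀ {x y} → x A.≈ y → to x B.≈ to y
    from-cong : ∀ {x y} → x B.≈ y → from x A.≈ from y
    to-from   : ∀ y → to (from y) B.≈ y
    from-to   : ∀ x → from (to x) A.≈ x
    to-∨ : ∀ x y → to (x A.∨ y) B.≈ (to x B.∨ to y)
    to-∧ : ∀ x y → to (x A.∧ y) B.≈ (to x B.∧ to y)
    to-¬ : ∀ x → to (A.¬ x) B.≈ B.¬ (to x)
    to-⊤ : to A.⊤ B.≈ B.⊤
    to-⊥ : to A.⊥ B.≈ B.⊥
    to-◇ : ∀ x → to (A.◇ x) B.≈ B.◇ (to x)

infixr 5 _⊗_
_⊗_ : ∀ {a b c d} → Alg a b → Alg c d → Alg (a ⊔ c) (b ⊔ d)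
A ⊗ B = record
  { Carrier = A.Carrier × B.Carrier
  ; _≈_ = λ x y → (proj₁ x A.≈ proj₁ y) × (proj₂ x B.≈ proj₂ y)
  ; isEquivalence = record
      { refl = AE.refl , BE.refl
      ; sym = λ p → AE.sym (proj₁ p) , BE.sym (proj₂ p)
      ; trans = λ p q → AE.trans (proj₁ p) (proj₁ q) , BE.trans (proj₂ p) (proj₂ q) }
  ; _∨_ = λ x y → (proj₁ x A.∨ proj₁ y) , (proj₂ x B.∨ proj₂ y)
  ; _∧_ = λ x y → (proj₁ x A.∧ proj₁ y) , (proj₂ x B.∧ proj₂ y)
  ; ¬_ = λ x → A.¬ proj₁ x , B.¬ proj₂ x
  ; ⊤ = A.⊤ , B.⊤
  ; ⊥ = A.⊥ , B.⊥
  ; ◇ = λ x → A.◇ (proj₁ x) , B.◇ (proj₂ x) }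
  where
    module A = Alg A
    module B = Alg B
    module AE = IsEquivalence A.isEquivalence
    module BE = IsEquivalence B.isEquivalence

One : Alg 0ℓ 0ℓ
One = record { Carrier = Unit ; _≈_ = _≡_ ; isEquivalence = ≡-isEquivalence
             ; _∨_ = λ _ _ → tt ; _∧_ = λ _ _ → tt ; ¬_ = λ _ → tt
             ; ⊤ = tt ; ⊥ = tt ; ◇ = λ _ → tt }

Prod : List (Alg 0ℓ 0ℓ) → Alg 0ℓ 0ℓ
Prod []       = One
Prod (A ∷ As) = A ⊗ Prod As

-- S_l : Boolean reduct 2^l (l atoms), ◇ a = 0 if a = 0 and 1 otherwise
-- (so the only closed elements are 0 and 1).  S 1 is the algebra 2.

allFalse : ∀ {n} → Vec Bool n → Bool
allFalse []       = true
allFalse (b ∷ bs) = bnot b and allFalse bs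

S : ℕ → Alg 0ℓ 0ℓ
S n = record
  { Carrier = Vec Bool n ; _≈_ = _≡_ ; isEquivalence = ≡-isEquivalence
  ; _∨_ = zipWith _or_ ; _∧_ = zipWith _and_ ; ¬_ = vmap bnot
  ; ⊤ = replicate n true ; ⊥ = replicate n false
  ; ◇ = λ v → if allFalse v then replicate n false else replicate n true }

-- The free algebra F_V(k) of rank k: terms over k generators modulo
-- the identities valid in V.

Free : Identities → ℕ → Alg 0ℓ (lsuc 0ℓ)
Free E k = record
  { Carrier = Term (Fin k)
  ; _≈_ = Valid E
  ; isEquivalence = record
      { refl = λ A _ ρ → IsEquivalence.refl (ClosureAlgebra.isEquivalence A)
      ; sym = λ p A m ρ → IsEquivalence.sym (ClosureAlgebra.isEquivalence A) (p A m ρ)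
      ; trans = λ p q A m ρ → IsEquivalence.trans (ClosureAlgebra.isEquivalence A) (p A m ρ) (q A m ρ) }
  ; _∨_ = _∨t_ ; _∧_ = _∧t_ ; ¬_ = ¬t_ ; ⊤ = ⊤t ; ⊥ = ⊥t ; ◇ = ◇t_ }

-- Let I : F_𝒲(k) ≅ 2^d × G, choose t with I t = (1, a) where a is an atom in every factor
-- S_l (l ≥ 2), and let e = □◇t ⇒ ◇□t.  By the McKinsey identity e = 1 in 𝒰, whereas
-- I e = (1, 0), because every element of 2^d satisfies it and no atom of S_l does.  Hence
-- (u, g) ↦ (u ∧ e) ∨ (I⁻¹(1, g) ∧ ¬e) is u in 𝒰 and has G-component g in 𝒲: it inverts
-- s ↦ (s, G-component of I s).  The 2^d-component is no extra datum, since 2 embeds into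
-- every nontrivial closure algebra, so the identities of 𝒰 already hold in 2^d.
module Submission where

open import Defs
open import Level using (Level; 0ℓ) renaming (suc to lsuc)
open import Data.Nat using (ℕ; _≤_; _<?_; zero; suc; s≤s)
open import Data.Fin using (Fin; toℕ; fromℕ<)
open import Data.Fin.Properties using (fromℕ<-toℕ; toℕ<n)
open import Data.Bool using (Bool; true; false)
open import Data.Vec as Vec using (Vec; []; _∷_)
open import Data.Vec.Properties using (map-replicate; zipWith-replicate)
open import Data.List using (List; []; _∷_; map; replicate)
open import Data.List.Relation.Unary.All using (All; []; _∷_; universal)
open import Data.List.Relation.Unary.All.Properties using (map⁺; replicate⁺)
open import Data.Product using (_,_; proj₁; proj₂)
open import Data.Empty using (⊥-elim)
open import Relation.Nullary using (yes; no)
import Relation.Nullary as Nullary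
open import Relation.Binary using (IsEquivalence; Setoid)
open import Relation.Binary.PropositionalEquality
  using (_≡_; refl; cong; cong₂; sym; trans; subst₂; module ≡-Reasoning)
open import Algebra.Lattice.Bundles using (BooleanAlgebra)
import Algebra.Lattice.Properties.BooleanAlgebra as BooleanAlgebraProperties
import Relation.Binary.Reasoning.Setoid as SetoidReasoning

private
  variable
    c₁ ℓ₁ c₂ ℓ₂ : Level

evalA : (A : Alg c₁ ℓ₁) {X : Set} → (X → Alg.Carrier A) → Term X → Alg.Carrier A
evalA A ρ (var x)  = ρ x
evalA A ρ ⊥t       = Alg.⊥ A
evalA A ρ ⊤t       = Alg.⊤ A
evalA A ρ (s ∨t t) = Alg._∨_ A (evalA A ρ s) (evalA A ρ t)
evalA A ρ (s ∧t t) = Alg._∧_ A (evalA A ρ s) (evalA A ρ t)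
evalA A ρ (¬t s)   = Alg.¬_ A (evalA A ρ s)
evalA A ρ (◇t s)   = Alg.◇ A (evalA A ρ s)

evalA-⊗ : (A : Alg c₁ ℓ₁) (B : Alg c₂ ℓ₂) {X : Set} (ρ : X → Alg.Carrier (A ⊗ B)) (s : Term X) →
          evalA (A ⊗ B) ρ s ≡ (evalA A (λ x → proj₁ (ρ x)) s , evalA B (λ x → proj₂ (ρ x)) s)
evalA-⊗ A B ρ (var x)  = refl
evalA-⊗ A B ρ ⊥t       = refl
evalA-⊗ A B ρ ⊤t       = refl
evalA-⊗ A B ρ (s ∨t t) = cong₂ (Alg._∨_ (A ⊗ B)) (evalA-⊗ A B ρ s) (evalA-⊗ A B ρ t)
evalA-⊗ A B ρ (s ∧t t) = cong₂ (Alg._∧_ (A ⊗ B)) (evalA-⊗ A B ρ s) (evalA-⊗ A B ρ t)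
evalA-⊗ A B ρ (¬t s)   = cong (Alg.¬_ (A ⊗ B)) (evalA-⊗ A B ρ s)
evalA-⊗ A B ρ (◇t s)   = cong (Alg.◇ (A ⊗ B)) (evalA-⊗ A B ρ s)

mckinseyᵗ : {X : Set} → Term X → Term X
mckinseyᵗ x = (□t ◇t x) ⇒t (◇t □t x)

mckinsey : (A : Alg c₁ ℓ₁) → Alg.Carrier A → Alg.Carrier A
mckinsey A x = ¬ □ (◇ x) ∨ ◇ (□ x)
  where
    open Alg A
    □ : Carrier → Carrier
    □ y = ¬ ◇ (¬ y)

selectᵗ : {X : Set} → Term X → Term X → Term X → Term X
selectᵗ e x y = (x ∧t e) ∨t (y ∧t ¬t e)

select : (A : Alg c₁ ℓ₁) → Alg.Carrier A → Alg.Carrier A → Alg.Carrier A → Alg.Carrier A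
select A e x y = (x ∧ e) ∨ (y ∧ ¬ e)
  where open Alg A

Discrete : Alg c₁ ℓ₁ → Set _
Discrete A = ∀ {x y} → x ≈ y → x ≡ y
  where open Alg A

⊗-discrete : {A : Alg c₁ ℓ₁} {B : Alg c₂ ℓ₂} → Discrete A → Discrete B → Discrete (A ⊗ B)
⊗-discrete dA dB (p , q) = cong₂ _,_ (dA p) (dB q)

Prod-discrete : ∀ {As} → All Discrete As → Discrete (Prod As)
Prod-discrete {As = []}     []         p = p
Prod-discrete {As = A ∷ As} (dA ∷ dAs) p = ⊗-discrete {A = A} {B = Prod As} dA (Prod-discrete dAs) p

S-discrete : ∀ n → Discrete (S n)
S-discrete n p = p

Satisfies : Identities → Alg 0ℓ 0ℓ → Set₁
Satisfies E A = ∀ {X : Set} (s t : Term X) → Valid E s t → ∀ ρ → evalA A ρ s ≈ evalA A ρ t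
  where open Alg A

⊗-satisfies : ∀ {E A B} → Satisfies E A → Satisfies E B → Satisfies E (A ⊗ B)
⊗-satisfies {A = A} {B} sA sB s t v ρ =
  subst₂ (Alg._≈_ (A ⊗ B)) (sym (evalA-⊗ A B ρ s)) (sym (evalA-⊗ A B ρ t)) (sA s t v _ , sB s t v _)

Prod-satisfies : ∀ {E As} → All (Satisfies E) As → Satisfies E (Prod As)
Prod-satisfies             []         s t v ρ = refl
Prod-satisfies {E} {A ∷ As} (sA ∷ sAs) =
  ⊗-satisfies {E} {A} {Prod As} sA (Prod-satisfies sAs)

module _ {A : Alg c₁ ℓ₁} {B : Alg c₂ ℓ₂} (I : Iso A B) where
  open Iso I

  to-injective : ∀ {x y} → Alg._≈_ B (to x) (to y) → Alg._≈_ A x y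
  to-injective {x} {y} p = ≈.trans (≈.sym (from-to x)) (≈.trans (from-cong p) (from-to y))
    where module ≈ = IsEquivalence (Alg.isEquivalence A)

module _ {E k} {B : Alg c₂ ℓ₂} (I : Iso (Free E k) B) (discrete : Discrete B) where
  open Iso I

  to-evalA : ∀ s → to s ≡ evalA B (λ i → to (var i)) s
  to-evalA (var i)  = refl
  to-evalA ⊥t       = discrete to-⊥
  to-evalA ⊤t       = discrete to-⊤
  to-evalA (s ∨t t) = trans (discrete (to-∨ s t)) (cong₂ (Alg._∨_ B) (to-evalA s) (to-evalA t))
  to-evalA (s ∧t t) = trans (discrete (to-∧ s t)) (cong₂ (Alg._∧_ B) (to-evalA s) (to-evalA t))
  to-evalA (¬t s)   = trans (discrete (to-¬ s)) (cong (Alg.¬_ B) (to-evalA s))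
  to-evalA (◇t s)   = trans (discrete (to-◇ s)) (cong (Alg.◇ B) (to-evalA s))

  to-mckinsey : ∀ s → to (mckinseyᵗ s) ≡ mckinsey B (to s)
  to-mckinsey s = trans (to-evalA (mckinseyᵗ s)) (cong (mckinsey B) (sym (to-evalA s)))

  to-select : ∀ e x y → to (selectᵗ e x y) ≡ select B (to e) (to x) (to y)
  to-select e x y = begin
    to (selectᵗ e x y)               ≡⟨ to-evalA (selectᵗ e x y) ⟩
    select B (ev e) (ev x) (ev y)    ≡⟨ cong₂ (λ p q → select B p q (ev y)) (sym (to-evalA e)) (sym (to-evalA x)) ⟩
    select B (to e) (to x) (ev y)    ≡⟨ cong (select B (to e) (to x)) (sym (to-evalA y)) ⟩
    select B (to e) (to x) (to y)    ∎
    where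
      open ≡-Reasoning
      ev : Term (Fin k) → Alg.Carrier B
      ev = evalA B (λ i → to (var i))

module _ (BA : BooleanAlgebra c₁ ℓ₁) where
  open BooleanAlgebra BA using (Carrier; _≈_; _∨_; _∧_; ¬_; ⊤; ⊥; setoid; ∨-cong; ∨-congˡ; ∧-congˡ; ¬-cong)
  open BooleanAlgebraProperties BA using (∧-identityʳ; ∧-zeroʳ; ∨-identityʳ; ¬⊤≈⊥)
  open SetoidReasoning setoid

  select-⊤ : ∀ {e} x y → e ≈ ⊤ → (x ∧ e) ∨ (y ∧ ¬ e) ≈ x
  select-⊤ {e} x y e≈⊤ = begin
    (x ∧ e) ∨ (y ∧ ¬ e) ≈⟨ ∨-cong (∧-congˡ e≈⊤) (∧-congˡ (¬-cong e≈⊤)) ⟩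
    (x ∧ ⊤) ∨ (y ∧ ¬ ⊤) ≈⟨ ∨-cong (∧-identityʳ x) (∧-congˡ ¬⊤≈⊥) ⟩
    x ∨ (y ∧ ⊥)         ≈⟨ ∨-congˡ (∧-zeroʳ y) ⟩
    x ∨ ⊥               ≈⟨ ∨-identityʳ x ⟩
    x                   ∎

module TwoElementSubalgebra (A : CA₀) (nontrivial : Nullary.¬ ClosureAlgebra._≈_ A (ClosureAlgebra.⊤ A) (ClosureAlgebra.⊥ A)) where
  open ClosureAlgebra A
  module ≈ = IsEquivalence isEquivalence
  private
    BA : BooleanAlgebra 0ℓ 0ℓ
    BA = record { isBooleanAlgebra = isBooleanAlgebra }
  open BooleanAlgebra BA using (∨-cong; ∧-cong; ¬-cong)
  open BooleanAlgebraProperties BA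

  embed : Vec Bool 1 → Carrier
  embed (true ∷ [])  = ⊤
  embed (false ∷ []) = ⊥

  ◇⊤≈⊤ : ◇ ⊤ ≈ ⊤
  ◇⊤≈⊤ = ≈.trans (≈.sym (◇-extensive ⊤)) (∨-zeroˡ (◇ ⊤))

  embed-∨ : ∀ x y → embed (Alg._∨_ (S 1) x y) ≈ embed x ∨ embed y
  embed-∨ (true ∷ [])  (true ∷ [])  = ≈.sym (∨-idem ⊤)
  embed-∨ (true ∷ [])  (false ∷ []) = ≈.sym (∨-identityʳ ⊤)
  embed-∨ (false ∷ []) (true ∷ [])  = ≈.sym (∨-identityˡ ⊤)
  embed-∨ (false ∷ []) (false ∷ []) = ≈.sym (∨-idem ⊥)

  embed-∧ : ∀ x y → embed (Alg._∧_ (S 1) x y) ≈ embed x ∧ embed y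
  embed-∧ (true ∷ [])  (true ∷ [])  = ≈.sym (∧-idem ⊤)
  embed-∧ (true ∷ [])  (false ∷ []) = ≈.sym (∧-zeroʳ ⊤)
  embed-∧ (false ∷ []) (true ∷ [])  = ≈.sym (∧-zeroˡ ⊤)
  embed-∧ (false ∷ []) (false ∷ []) = ≈.sym (∧-idem ⊥)

  embed-¬ : ∀ x → embed (Alg.¬_ (S 1) x) ≈ ¬ embed x
  embed-¬ (true ∷ [])  = ≈.sym ¬⊤≈⊥
  embed-¬ (false ∷ []) = ≈.sym ¬⊥≈⊤

  embed-◇ : ∀ x → embed (Alg.◇ (S 1) x) ≈ ◇ (embed x)
  embed-◇ (true ∷ [])  = ≈.sym ◇⊤≈⊤
  embed-◇ (false ∷ []) = ≈.sym ◇-⊥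

  embed-evalA : ∀ {X : Set} (ρ : X → Vec Bool 1) s → embed (evalA (S 1) ρ s) ≈ eval A (λ x → embed (ρ x)) s
  embed-evalA ρ (var x)  = ≈.refl
  embed-evalA ρ ⊥t       = ≈.refl
  embed-evalA ρ ⊤t       = ≈.refl
  embed-evalA ρ (s ∨t t) = ≈.trans (embed-∨ (evalA (S 1) ρ s) (evalA (S 1) ρ t)) (∨-cong (embed-evalA ρ s) (embed-evalA ρ t))
  embed-evalA ρ (s ∧t t) = ≈.trans (embed-∧ (evalA (S 1) ρ s) (evalA (S 1) ρ t)) (∧-cong (embed-evalA ρ s) (embed-evalA ρ t))
  embed-evalA ρ (¬t s)   = ≈.trans (embed-¬ (evalA (S 1) ρ s)) (¬-cong (embed-evalA ρ s))
  embed-evalA ρ (◇t s)   = ≈.trans (embed-◇ (evalA (S 1) ρ s)) (◇-cong (embed-evalA ρ s))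

  embed-injective : ∀ x y → embed x ≈ embed y → x ≡ y
  embed-injective (true ∷ [])  (true ∷ [])  _ = refl
  embed-injective (true ∷ [])  (false ∷ []) p = ⊥-elim (nontrivial p)
  embed-injective (false ∷ []) (true ∷ [])  p = ⊥-elim (nontrivial (≈.sym p))
  embed-injective (false ∷ []) (false ∷ []) _ = refl

S1-satisfies : ∀ {E} → Nontrivial E → Satisfies E (S 1)
S1-satisfies (A , models , nontrivial) s t v ρ =
  embed-injective _ _ (≈.trans (embed-evalA ρ s) (≈.trans (v A models _) (≈.sym (embed-evalA ρ t))))
  where open TwoElementSubalgebra A nontrivial

S-select-⊤ : ∀ {n} (x y : Vec Bool n) → select (S n) (Alg.⊤ (S n)) x y ≡ x
S-select-⊤ [] [] = refl
S-select-⊤ (p ∷ x) (q ∷ y) = cong₂ Vec._++_ (head p q) (S-select-⊤ x y)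
  where
    head : ∀ p q → select (S 1) (true ∷ []) (p ∷ []) (q ∷ []) ≡ p ∷ []
    head true  true  = refl
    head true  false = refl
    head false true  = refl
    head false false = refl

S-select-⊥ : ∀ {n} (x y : Vec Bool n) → select (S n) (Alg.⊥ (S n)) x y ≡ y
S-select-⊥ [] [] = refl
S-select-⊥ (p ∷ x) (q ∷ y) = cong₂ Vec._++_ (head p q) (S-select-⊥ x y)
  where
    head : ∀ p q → select (S 1) (false ∷ []) (p ∷ []) (q ∷ []) ≡ q ∷ []
    head true  true  = refl
    head true  false = refl
    head false true  = refl
    head false false = refl

module _ {n : ℕ} where
  open Alg (S n)

  S-¬⊤ : ¬ ⊤ ≡ ⊥
  S-¬⊤ = map-replicate _ true n

  S-¬⊥ : ¬ ⊥ ≡ ⊤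
  S-¬⊥ = map-replicate _ false n

  S-◇⊥ : ◇ ⊥ ≡ ⊥
  S-◇⊥ = cong (λ b → Data.Bool.if b then ⊥ else ⊤) (allFalse-⊥ n)
    where
      allFalse-⊥ : ∀ m → allFalse (Vec.replicate m false) ≡ true
      allFalse-⊥ zero    = refl
      allFalse-⊥ (suc m) = allFalse-⊥ m

  S-⊥∨⊥ : ⊥ ∨ ⊥ ≡ ⊥
  S-⊥∨⊥ = zipWith-replicate Data.Bool._∨_ false false

S1-mckinsey : ∀ x → mckinsey (S 1) x ≡ Alg.⊤ (S 1)
S1-mckinsey (true ∷ [])  = refl
S1-mckinsey (false ∷ []) = refl

atom : ∀ n → Vec Bool (suc (suc n))
atom n = true ∷ Vec.replicate (suc n) false

-- The first step is definitional: the atom and its complement are nonzero, so ◇ sends both to 1.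
S-mckinsey-atom : ∀ n → mckinsey (S (suc (suc n))) (atom n) ≡ Alg.⊥ (S (suc (suc n)))
S-mckinsey-atom n = begin
  mckinsey (S _) (atom n) ≡⟨⟩
  ¬ (¬ ◇ (¬ ⊤)) ∨ ◇ (¬ ⊤) ≡⟨ cong (λ z → ¬ (¬ ◇ z) ∨ ◇ z) S-¬⊤ ⟩
  ¬ (¬ ◇ ⊥) ∨ ◇ ⊥         ≡⟨ cong (λ z → ¬ (¬ z) ∨ z) S-◇⊥ ⟩
  ¬ (¬ ⊥) ∨ ⊥             ≡⟨ cong (λ z → ¬ z ∨ ⊥) S-¬⊥ ⟩
  ¬ ⊤ ∨ ⊥                 ≡⟨ cong (_∨ ⊥) S-¬⊤ ⟩
  ⊥ ∨ ⊥                   ≡⟨ S-⊥∨⊥ ⟩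
  ⊥                       ∎
  where
    open ≡-Reasoning
    open Alg (S (suc (suc n)))

2^ : ℕ → Alg 0ℓ 0ℓ
2^ d = Prod (replicate d (S 1))

G : List ℕ → Alg 0ℓ 0ℓ
G ls = Prod (map S ls)

2^-discrete : ∀ d → Discrete (2^ d)
2^-discrete d = Prod-discrete (replicate⁺ d (S-discrete 1))

G-discrete : ∀ ls → Discrete (G ls)
G-discrete ls = Prod-discrete (map⁺ (universal S-discrete ls))

2^-satisfies : ∀ {E} → Nontrivial E → ∀ d → Satisfies E (2^ d)
2^-satisfies {E} nontrivial d =
  Prod-satisfies {E} {replicate d (S 1)} (replicate⁺ {P = Satisfies E} d (S1-satisfies nontrivial))

2^-select-⊤ : ∀ d x y → select (2^ d) (Alg.⊤ (2^ d)) x y ≡ x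
2^-select-⊤ zero    _        _        = refl
2^-select-⊤ (suc d) (x , xs) (y , ys) = cong₂ _,_ (S-select-⊤ x y) (2^-select-⊤ d xs ys)

G-select-⊥ : ∀ ls x y → select (G ls) (Alg.⊥ (G ls)) x y ≡ y
G-select-⊥ []       _        _        = refl
G-select-⊥ (l ∷ ls) (x , xs) (y , ys) = cong₂ _,_ (S-select-⊥ x y) (G-select-⊥ ls xs ys)

2^-mckinsey : ∀ d x → mckinsey (2^ d) x ≡ Alg.⊤ (2^ d)
2^-mckinsey zero    _        = refl
2^-mckinsey (suc d) (x , xs) = cong₂ _,_ (S1-mckinsey x) (2^-mckinsey d xs)

atoms : ∀ ls → All (2 ≤_) ls → Alg.Carrier (G ls)
atoms []                 []                = _
atoms (suc (suc n) ∷ ls) (s≤s (s≤s _) ∷ h) = atom n , atoms ls h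

G-mckinsey-atoms : ∀ ls h → mckinsey (G ls) (atoms ls h) ≡ Alg.⊥ (G ls)
G-mckinsey-atoms []                 []                = refl
G-mckinsey-atoms (suc (suc n) ∷ ls) (s≤s (s≤s _) ∷ h) = cong₂ _,_ (S-mckinsey-atom n) (G-mckinsey-atoms ls h)

ren : {X Y : Set} → (X → Y) → Term X → Term Y
ren f (var x)  = var (f x)
ren f ⊥t       = ⊥t
ren f ⊤t       = ⊤t
ren f (s ∨t t) = ren f s ∨t ren f t
ren f (s ∧t t) = ren f s ∧t ren f t
ren f (¬t s)   = ¬t ren f s
ren f (◇t s)   = ◇t ren f s

module _ (A : CA₀) where
  open ClosureAlgebra A

  eval-ren : {X Y : Set} (f : X → Y) {ρ : X → Carrier} {σ : Y → Carrier} →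
             (∀ x → σ (f x) ≡ ρ x) → ∀ s → eval A σ (ren f s) ≡ eval A ρ s
  eval-ren f σf≡ρ (var x)  = σf≡ρ x
  eval-ren f σf≡ρ ⊥t       = refl
  eval-ren f σf≡ρ ⊤t       = refl
  eval-ren f σf≡ρ (s ∨t t) = cong₂ _∨_ (eval-ren f σf≡ρ s) (eval-ren f σf≡ρ t)
  eval-ren f σf≡ρ (s ∧t t) = cong₂ _∧_ (eval-ren f σf≡ρ s) (eval-ren f σf≡ρ t)
  eval-ren f σf≡ρ (¬t s)   = cong ¬_ (eval-ren f σf≡ρ s)
  eval-ren f σf≡ρ (◇t s)   = cong ◇ (eval-ren f σf≡ρ s)

  extend : ∀ {k} → (Fin k → Carrier) → ℕ → Carrier
  extend {k} ρ n with n <? k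
  ... | yes n<k = ρ (fromℕ< n<k)
  ... | no  _   = ⊥

  extend-toℕ : ∀ {k} (ρ : Fin k → Carrier) i → extend ρ (toℕ i) ≡ ρ i
  extend-toℕ {k} ρ i with toℕ i <? k
  ... | yes i<k = cong ρ (fromℕ<-toℕ i i<k)
  ... | no  i≮k = ⊥-elim (i≮k (toℕ<n i))

-- The join is presented by identities over ℕ, so an identity over Fin k is renamed along toℕ.
join-intro : ∀ U W {k} (s t : Term (Fin k)) → Valid U s t → Valid W s t → Valid (join U W) s t
join-intro U W s t vU vW A models ρ =
  subst₂ (ClosureAlgebra._≈_ A) (eval-ren A toℕ (extend-toℕ A ρ) s) (eval-ren A toℕ (extend-toℕ A ρ) t)
    (models (ren toℕ s) (ren toℕ t) (renamed vU , renamed vW) (extend A ρ))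
  where
    renamed : ∀ {E} → Valid E s t → Valid E (ren toℕ s) (ren toℕ t)
    renamed v B modelsB σ =
      subst₂ (ClosureAlgebra._≈_ B) (sym (eval-ren B toℕ (λ _ → refl) s)) (sym (eval-ren B toℕ (λ _ → refl) t))
        (v B modelsB (λ i → σ (toℕ i)))

join-elimˡ : ∀ U W {X : Set} (s t : Term X) → Valid (join U W) s t → Valid U s t
join-elimˡ U W s t v A models = v A (λ _ _ vUW → proj₁ vUW A models)

join-elimʳ : ∀ U W {X : Set} (s t : Term X) → Valid (join U W) s t → Valid W s t
join-elimʳ U W s t v A models = v A (λ _ _ vUW → proj₂ vUW A models)

free-setoid : Identities → ℕ → Setoid 0ℓ (lsuc 0ℓ)
free-setoid E k = record { isEquivalence = Alg.isEquivalence (Free E k) }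

module JoinFree (U W : Identities) (nontrivial : Nontrivial U) (mcKinsey : McKinsey U)
                (k d : ℕ) (ls : List ℕ) (h : All (2 ≤_) ls) (I : Iso (Free W k) (2^ d ⊗ G ls)) where
  open Iso I
  T : Alg 0ℓ 0ℓ
  T = 2^ d ⊗ G ls

  T-discrete : Discrete T
  T-discrete = ⊗-discrete {A = 2^ d} {B = G ls} (2^-discrete d) (G-discrete ls)

  fromG : Alg.Carrier (G ls) → Term (Fin k)
  fromG g = from (Alg.⊤ (2^ d) , g)

  e : Term (Fin k)
  e = mckinseyᵗ (fromG (atoms ls h))

  U-select-e : ∀ x y → Valid U (selectᵗ e x y) x
  U-select-e x y A models ρ = select-⊤ (record { isBooleanAlgebra = isBooleanAlgebra }) _ _
    (mcKinsey A models (λ _ → eval A ρ (fromG (atoms ls h))))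
    where open ClosureAlgebra A

  to-e : to e ≡ (Alg.⊤ (2^ d) , Alg.⊥ (G ls))
  to-e = trans (to-mckinsey I T-discrete _)
    (trans (cong (mckinsey T) (T-discrete (to-from _))) (cong₂ _,_ (2^-mckinsey d _) (G-mckinsey-atoms ls h)))

  2^-component : ∀ s → proj₁ (to s) ≡ evalA (2^ d) (λ i → proj₁ (to (var i))) s
  2^-component s = cong proj₁ (trans (to-evalA I T-discrete s) (evalA-⊗ (2^ d) (G ls) _ s))

  2^-component-cong : ∀ {s t} → Valid U s t → proj₁ (to s) ≡ proj₁ (to t)
  2^-component-cong {s} {t} v = trans (2^-component s)
    (trans (2^-discrete d (2^-satisfies nontrivial d s t v _)) (sym (2^-component t)))

  glue : Alg.Carrier (Free U k ⊗ G ls) → Term (Fin k)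
  glue (u , g) = selectᵗ e u (fromG g)

  to-glue : ∀ u g → to (glue (u , g)) ≡ (proj₁ (to u) , g)
  to-glue u g = trans (to-select I T-discrete _ _ _)
    (trans (cong₂ (λ p q → select T p (to u) q) to-e (T-discrete (to-from _)))
           (cong₂ _,_ (2^-select-⊤ d _ _) (G-select-⊥ ls _ g)))

  glue-cong : ∀ {x y} → Alg._≈_ (Free U k ⊗ G ls) x y → Valid (join U W) (glue x) (glue y)
  glue-cong {u , g} {u′ , g′} (u≈u′ , g≈g′) = join-intro U W (glue (u , g)) (glue (u′ , g′)) in-U in-W
    where
      open SetoidReasoning (free-setoid U k)
      in-U : Valid U (glue (u , g)) (glue (u′ , g′))
      in-U = begin
        glue (u , g)   ≈⟨ U-select-e u (fromG g) ⟩
        u              ≈⟨ u≈u′ ⟩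
        u′             ≈⟨ U-select-e u′ (fromG g′) ⟨
        glue (u′ , g′) ∎
      in-W : Valid W (glue (u , g)) (glue (u′ , g′))
      in-W = to-injective I {glue (u , g)} {glue (u′ , g′)} (IsEquivalence.reflexive (Alg.isEquivalence T)
        (trans (to-glue u g) (trans (cong₂ _,_ (2^-component-cong u≈u′) (G-discrete ls g≈g′)) (sym (to-glue u′ g′)))))

  glue-to : ∀ s → Valid (join U W) (glue (s , proj₂ (to s))) s
  glue-to s = join-intro U W (glue (s , _)) s (U-select-e s (fromG (proj₂ (to s))))
    (to-injective I {glue (s , _)} {s} (IsEquivalence.reflexive (Alg.isEquivalence T) (to-glue s _)))

  iso : Iso (Free (join U W) k) (Free U k ⊗ G ls)
  iso = record
    { to        = λ s → s , proj₂ (to s)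
    ; from      = glue
    ; to-cong   = λ {s} {t} p → join-elimˡ U W s t p , proj₂ (to-cong {s} {t} (join-elimʳ U W s t p))
    ; from-cong = λ {x} {y} → glue-cong {x} {y}
    ; to-from   = λ { (u , g) → U-select-e u (fromG g) , IsEquivalence.reflexive (Alg.isEquivalence (G ls)) (cong proj₂ (to-glue u g)) }
    ; from-to   = glue-to
    ; to-∨      = λ x y → refl-U (x ∨t y) , proj₂ (to-∨ x y)
    ; to-∧      = λ x y → refl-U (x ∧t y) , proj₂ (to-∧ x y)
    ; to-¬      = λ x → refl-U (¬t x) , proj₂ (to-¬ x)
    ; to-⊤      = refl-U ⊤t , proj₂ to-⊤
    ; to-⊥      = refl-U ⊥t , proj₂ to-⊥
    ; to-◇      = λ x → refl-U (◇t x) , proj₂ (to-◇ x)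
    }
    where
      refl-U : ∀ s → Valid U s s
      refl-U s = Setoid.refl (free-setoid U k) {s}

-- 𝒲 being monadic is what yields the decomposition of F_𝒲(k); given that, it is not used again.
proposition8p2 : (U W : Identities) → Nontrivial U → McKinsey U → MonadicVariety W →
    (k d : ℕ) (ls : List ℕ) → All (2 ≤_) ls →
    Iso (Free W k) (Prod (replicate d (S 1)) ⊗ Prod (map S ls)) →
    Iso (Free (join U W) k) (Free U k ⊗ Prod (map S ls))
proposition8p2 U W nontrivial mcKinsey _ k d ls h I = JoinFree.iso U W nontrivial mcKinsey k d ls h I
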